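{- Let $p$ be a prime and $f(x)=c_1+c_2x^d\in\mathbb{Z}[x]$ with $c_1c_2\not\equiv 0 \pmod p$, and let $\ell:=\operatorname{ord}_p d$. Then for every $k\in\mathbb{N}$, every non-root nodal polynomial $f_{i,\zeta}$ of $\mathcal{T}_{p,k}(f)$ satisfies $\deg\tilde f_{i,\zeta}\leq 2$ or $\deg\tilde f_{i,\zeta}\leq 1$, according as $p=2$ or $p\geq 3$. In particular, if $f(\zeta_0)\equiv 0\pmod p$ for some $\zeta_0\in\{0,\ldots,p-1\}$ that is a degenerate root of $\tilde f$, then $s(f,\zeta_0)\leq\ell+1$.
   Context: For $g\in\mathbb{Z}[x]$, $\tilde g$ is its reduction mod $p$; $\mathbb{F}_p$ is identified with $\{0,\ldots,p-1\}$. A root $\zeta$ of $g$ is degenerate if $g(\zeta)=g'(\zeta)=0$. For $\tilde g\neq 0$ and a degenerate root $\zeta_0$ of $\tilde g$, $s(g,\zeta_0):=\min_{i\geq 0}\{i+\operatorname{ord}_p\frac{g^{(i)}(\zeta_0)}{i!}\}$. The tree $\mathcal{T}_{p,k}(f)$: root node $(f_{0,0},k_{0,0}):=(f,k)$; for $i\geq 1$, for each node $(f_{i-1,\mu},k_{i-1,\mu})$ and each degenerate root $\zeta_{i-1}\in\mathbb{F}_p$ of $\tilde f_{i-1,\mu}$ with $s_{i-1}:=s(f_{i-1,\mu},\zeta_{i-1})\in\{2,\ldots,k_{i-1,\mu}-1\}$, one adds a child node $(f_{i,\zeta},k_{i,\zeta})$ with $\zeta:=\mu+\zeta_{i-1}p^{i-1}$,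 $k_{i,\zeta}:=k_{i-1,\mu}-s_{i-1}$, $f_{i,\zeta}(x):=p^{ -s_{i-1}}f_{i-1,\mu}(\zeta_{i-1}+px)\bmod p^{k_{i,\zeta}}$. The $f_{i,\zeta}$ are called nodal polynomials; non-root nodal polynomials are those with $i\geq 1$. -}

module Defs where

open import Data.Nat as ℕ using (ℕ; zero; suc; _∸_; NonZero)
open import Data.Nat.Properties using (m^n≢0)
open import Data.Nat.Primality using (Prime; prime⇒nonZero)
open import Data.Nat.Combinatorics using (_C_)
open import Data.Integer as ℤ using (ℤ; +_; 0ℤ; _/ℕ_; _%ℕ_)
open import Data.Integer.Divisibility using (_∣_)
open import Data.List using (List; []; _∷_; length; map; foldr; upTo; replicate; _++_)
open import Data.Product using (Σ; _×_; ∃)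
open import Relation.Nullary using (¬_)
open import Relation.Binary.PropositionalEquality using (_≡_; _≢_)

-- Integer polynomials: coefficient lists, constant term first.
Poly : Set
Poly = List ℤ

coeff : Poly → ℕ → ℤ
coeff []       _       = 0ℤ
coeff (a ∷ _)  zero    = a
coeff (_ ∷ as) (suc j) = coeff as j

sumℤ : List ℤ → ℤ
sumℤ = foldr ℤ._+_ 0ℤ

eval : Poly → ℤ → ℤ
eval g z = sumℤ (map (λ j → coeff g j ℤ.* (z ℤ.^ j)) (upTo (length g)))

evalDeriv : Poly → ℤ → ℤ
evalDeriv g z = sumℤ (map (λ j → (+ j) ℤ.* coeff g j ℤ.* (z ℤ.^ (j ∸ 1))) (upTo (length g)))

-- g^{(i)}(z) / i!  =  Σ_j binom(j,i) c_j z^{j-i}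
taylor : Poly → ℤ → ℕ → ℤ
taylor g z i = sumℤ (map (λ j → + (j C i) ℤ.* coeff g j ℤ.* (z ℤ.^ (j ∸ i))) (upTo (length g)))

-- ord_p a = n   (for a ≠ 0)
Ord : ℕ → ℤ → ℕ → Set
Ord p a n = (+ (p ℕ.^ n) ∣ a) × ¬ (+ (p ℕ.^ suc n) ∣ a)

RedNonzero : ℕ → Poly → Set
RedNonzero p g = ∃ λ j → ¬ (+ p ∣ coeff g j)

-- deg (g mod p) ≤ n   (the zero polynomial has degree -∞)
DegRedLe : ℕ → Poly → ℕ → Set
DegRedLe p g n = ∀ j → n ℕ.< j → + p ∣ coeff g j

DegenerateRoot : ℕ → Poly → ℕ → Set
DegenerateRoot p g ζ = (ζ ℕ.< p) × (+ p ∣ eval g (+ ζ)) × (+ p ∣ evalDeriv g (+ ζ))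

-- s(g,ζ) = s :  s = min_i { i + ord_p (g^{(i)}(ζ)/i!) }  (terms with value 0 have ord = ∞)
IsS : ℕ → Poly → ℕ → ℕ → Set
IsS p g ζ s =
  (Σ ℕ λ i → Σ ℕ λ n → (taylor g (+ ζ) i ≢ 0ℤ) × Ord p (taylor g (+ ζ) i) n × (i ℕ.+ n ≡ s))
  × (∀ i n → taylor g (+ ζ) i ≢ 0ℤ → Ord p (taylor g (+ ζ) i) n → s ℕ.≤ i ℕ.+ n)

-- p^{-s} g(ζ + p x) mod p^{k'}, coefficients reduced into {0,…,p^{k'}-1}.
-- The coefficient of x^j in g(ζ+px) is p^j g^{(j)}(ζ)/j!.
childPoly : (p : ℕ) → .{{NonZero p}} → Poly → ℕ → ℕ → ℕ → Poly
childPoly p g ζ s k' =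
  map (λ j → + ((((+ (p ℕ.^ j)) ℤ.* taylor g (+ ζ) j) /ℕ (p ℕ.^ s)) {{m^n≢0 p s}}
                  %ℕ (p ℕ.^ k')) {{m^n≢0 p k'}})
      (upTo (length g))

-- Node p f k i ζ g k' : (g , k') = (f_{i,ζ} , k_{i,ζ}) is a node of T_{p,k}(f).
data Node (p : ℕ) .{{_ : NonZero p}} (f : Poly) (k : ℕ) : ℕ → ℕ → Poly → ℕ → Set where
  root  : Node p f k 0 0 f k
  child : ∀ {i μ g kk} (ζ₀ s : ℕ) →
          Node p f k i μ g kk →
          RedNonzero p g →
          DegenerateRoot p g ζ₀ →
          IsS p g ζ₀ s →
          2 ℕ.≤ s → s ℕ.< kk →
          Node p f k (suc i) (μ ℕ.+ ζ₀ ℕ.* p ℕ.^ i) (childPoly p g ζ₀ s (kk ∸ s)) (kk ∸ s)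

IsNode : (p : ℕ) → Prime p → Poly → ℕ → ℕ → ℕ → Poly → ℕ → Set
IsNode p pr = Node p {{prime⇒nonZero pr}}

-- f(x) = c₁ + c₂ x^d  (d ≥ 1)
binomial : ℤ → ℤ → ℕ → Poly
binomial c₁ c₂ d = c₁ ∷ (replicate (d ∸ 1) 0ℤ ++ (c₂ ∷ []))

module Submission where

-- Let ζ₀ be a root of f = c₁ + c₂ xᵈ mod p. As f(0) = c₁ is a unit, p ∤ ζ₀, so the Taylor coefficient
-- f⁽ʲ⁾(ζ₀)/j! = C(d,j) c₂ ζ₀ᵈ⁻ʲ has the valuation of C(d,j). From j C(d,j) = d C(d-1,j-1) we get
-- v_p(pʲ C(d,j)) ≥ ℓ + j - v_p(j), which is ≥ ℓ + 1 for j ≥ 1 and ≥ ℓ + 2 for j ≥ 2 unless p = j = 2,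
-- while for j = 1 the valuation of f'(ζ₀) is exactly ℓ. Hence s ≤ ℓ + 1, and the coefficients p^(j-s)
-- f⁽ʲ⁾(ζ₀)/j! of the child in degrees j ≥ 2 (j ≥ 3 if p = 2) vanish mod p. The child has no degenerate
-- root, so the tree has depth at most one: if s ≤ ℓ it is constant mod p, and if s = ℓ + 1 its linear
-- coefficient is a unit while the other terms of its derivative vanish mod p.

module Arithmetic where

  open import Data.Nat
  open import Data.Nat.Properties
  open import Data.Nat.Divisibility
  open import Data.Nat.Combinatorics using (_C_; nC1≡n; nCk+nC[k+1]≡[n+1]C[k+1])
  open import Data.Nat.Primality using (Prime; euclidsLemma; prime⇒nonZero; prime⇒nonTrivial)
  open import Data.Nat.Induction using (<-wellFounded)
  open import Data.Nat.Tactic.RingSolver using (solve-∀)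
  open import Induction.WellFounded using (Acc; acc)
  open import Data.Product using (∃₂; _×_; _,_)
  open import Data.Sum using (_⊎_; inj₁; inj₂)
  open import Relation.Nullary using (yes; no; contradiction)
  open import Relation.Binary.PropositionalEquality

  [k+1]*[n+1]C[k+1]≡[n+1]*nCk : ∀ n k → suc k * (suc n C suc k) ≡ suc n * (n C k)
  [k+1]*[n+1]C[k+1]≡[n+1]*nCk zero    zero    = refl
  [k+1]*[n+1]C[k+1]≡[n+1]*nCk zero    (suc k) = *-zeroʳ (2 + k)
  [k+1]*[n+1]C[k+1]≡[n+1]*nCk (suc n) zero    =
    trans (+-identityʳ _) (trans (nC1≡n (2 + n)) (sym (*-identityʳ (2 + n))))
  [k+1]*[n+1]C[k+1]≡[n+1]*nCk (suc n) (suc k) = begin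
    (2 + k) * ((2 + n) C (2 + k))   ≡⟨ cong ((2 + k) *_) (nCk+nC[k+1]≡[n+1]C[k+1] (suc n) (suc k)) ⟨
    (2 + k) * (A + B)               ≡⟨ regroup k A B ⟩
    A + ((1 + k) * A + (2 + k) * B) ≡⟨ cong₂ (λ x y → A + (x + y)) ih₁ ih₂ ⟩
    A + ((1 + n) * a + (1 + n) * b) ≡⟨ cong (A +_) (*-distribˡ-+ (1 + n) a b) ⟨
    A + (1 + n) * (a + b)           ≡⟨ cong (λ x → A + (1 + n) * x) (nCk+nC[k+1]≡[n+1]C[k+1] n k) ⟩
    A + (1 + n) * A                 ∎
    where
    open ≡-Reasoning
    A = suc n C suc k
    B = suc n C (2 + k)
    a = n C k
    b = n C suc k
    ih₁ = [k+1]*[n+1]C[k+1]≡[n+1]*nCk n k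
    ih₂ = [k+1]*[n+1]C[k+1]≡[n+1]*nCk n (suc k)
    regroup : ∀ k A B → (2 + k) * (A + B) ≡ A + ((1 + k) * A + (2 + k) * B)
    regroup = solve-∀

  m<n⇒1+m<o*n : ∀ {m n o} → 1 < o → m < n → suc m < o * n
  m<n⇒1+m<o*n {m} {n} {o} 1<o m<n = begin-strict
    suc m  ≤⟨ m<n ⟩
    n      <⟨ m<m*n n o {{>-nonZero (≤-<-trans z≤n m<n)}} 1<o ⟩
    n * o  ≡⟨ *-comm n o ⟩
    o * n  ∎
    where open ≤-Reasoning

  n<m^n : ∀ {m} → 1 < m → ∀ n → n < m ^ n
  n<m^n 1<m zero    = s≤s z≤n
  n<m^n 1<m (suc n) = m<n⇒1+m<o*n 1<m (n<m^n 1<m n)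

  2+n≤m^n : ∀ {m} → 1 < m → ∀ n → 2 ≤ n → 2 + n ≤ m ^ n
  2+n≤m^n 1<m (suc zero)          (s≤s ())
  2+n≤m^n 1<m (suc (suc zero))    _ = *-mono-≤ 1<m (*-mono-≤ 1<m ≤-refl)
  2+n≤m^n 1<m (suc (suc (suc n))) _ = m<n⇒1+m<o*n 1<m (2+n≤m^n 1<m (suc (suc n)) (s≤s (s≤s z≤n)))

  ^-monoʳ-∣ : ∀ m {a b} → a ≤ b → m ^ a ∣ m ^ b
  ^-monoʳ-∣ m {a} {b} a≤b = divides (m ^ (b ∸ a)) (begin
    m ^ b                 ≡⟨ cong (m ^_) (m+[n∸m]≡n a≤b) ⟨
    m ^ (a + (b ∸ a))     ≡⟨ ^-distribˡ-+-* m a (b ∸ a) ⟩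
    m ^ a * m ^ (b ∸ a)   ≡⟨ *-comm (m ^ a) _ ⟩
    m ^ (b ∸ a) * m ^ a   ∎)
    where open ≡-Reasoning

  module PrimePowers {p : ℕ} (pr : Prime p) where

    private instance
      p≢0 : NonZero p
      p≢0 = prime⇒nonZero pr

    1<p : 1 < p
    1<p = nonTrivial⇒n>1 p {{prime⇒nonTrivial pr}}

    ∤-* : ∀ {m n} → p ∤ m → p ∤ n → p ∤ m * n
    ∤-* {m} {n} p∤m p∤n p∣mn with euclidsLemma m n pr p∣mn
    ... | inj₁ p∣m = p∤m p∣m
    ... | inj₂ p∣n = p∤n p∣n

    ∤-^ : ∀ {m} n → p ∤ m → p ∤ m ^ n
    ∤-^ zero    p∤m p∣1 = <⇒≢ 1<p (sym (∣1⇒≡1 p∣1))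
    ∤-^ (suc n) p∤m     = ∤-* p∤m (∤-^ n p∤m)

    p^n∣m*u⇒p^n∣m : ∀ n {m u} → p ∤ u → p ^ n ∣ m * u → p ^ n ∣ m
    p^n∣m*u⇒p^n∣m zero    p∤u _ = 1∣ _
    p^n∣m*u⇒p^n∣m (suc n) {m} {u} p∤u p^[1+n]∣mu
      with euclidsLemma m u pr (m*n∣⇒m∣ p (p ^ n) p^[1+n]∣mu)
    ... | inj₂ p∣u = contradiction p∣u p∤u
    ... | inj₁ (divides q refl) = begin
      p * p ^ n  ∣⟨ *-monoʳ-∣ p (p^n∣m*u⇒p^n∣m n p∤u p^n∣qu) ⟩
      p * q      ≡⟨ *-comm p q ⟩
      q * p      ∎
      where
      open ∣-Reasoning
      reorder : ∀ q p u → q * p * u ≡ p * (q * u)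
      reorder = solve-∀
      p^n∣qu : p ^ n ∣ q * u
      p^n∣qu = *-cancelˡ-∣ p (subst (p * p ^ n ∣_) (reorder q p u) p^[1+n]∣mu)

    p-adic-split : ∀ n .{{_ : NonZero n}} → ∃₂ λ m u → n ≡ p ^ m * u × p ∤ u
    p-adic-split n = split n (<-wellFounded n)
      where
      split : ∀ n .{{_ : NonZero n}} → Acc _<_ n → ∃₂ λ m u → n ≡ p ^ m * u × p ∤ u
      split n (acc rec) with p ∣? n
      ... | no p∤n = 0 , n , sym (+-identityʳ n) , p∤n
      ... | yes (divides q refl) =
        let instance q≢0 = m*n≢0⇒m≢0 q
            (m , u , q≡p^m*u , p∤u) = split q (rec (m<m*n q p 1<p))
        in suc m , u , trans (cong (_* p) q≡p^m*u) (reorder (p ^ m) u p) , p∤u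
        where
        reorder : ∀ x u p → x * u * p ≡ p * x * u
        reorder = solve-∀

    p^m∣n⇒1+m≤n : ∀ {m n} .{{_ : NonZero n}} → p ^ m ∣ n → 1 + m ≤ n
    p^m∣n⇒1+m≤n {m} p^m∣n = ≤-trans (n<m^n 1<p m) (∣⇒≤ p^m∣n)

    p^m∣n⇒2+m≤n : ∀ {m n} → 2 ≤ n → 3 ≤ p ⊎ 3 ≤ n → p ^ m ∣ n → 2 + m ≤ n
    p^m∣n⇒2+m≤n {zero}             2≤n _          _     = 2≤n
    p^m∣n⇒2+m≤n {suc zero}         _   (inj₂ 3≤n) _     = 3≤n
    p^m∣n⇒2+m≤n {suc zero} {suc _} _   (inj₁ 3≤p) p^1∣n =
      ≤-trans 3≤p (≤-trans (≤-reflexive (sym (*-identityʳ p))) (∣⇒≤ p^1∣n))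
    p^m∣n⇒2+m≤n {suc (suc m)} {suc _} _ _        p^m∣n =
      ≤-trans (2+n≤m^n 1<p (2 + m) (s≤s (s≤s z≤n))) (∣⇒≤ p^m∣n)

    -- The hypothesis on c says that c ≤ n - v_p(n).
    p^[ℓ+c]∣p^n*a : ∀ {ℓ n a} c .{{_ : NonZero n}} → (∀ {m} → p ^ m ∣ n → c + m ≤ n) →
                    p ^ ℓ ∣ n * a → p ^ (ℓ + c) ∣ p ^ n * a
    p^[ℓ+c]∣p^n*a {ℓ} {n} {a} c bound p^ℓ∣na with p-adic-split n
    ... | m , u , refl , p∤u = begin
      p ^ (ℓ + c)              ∣⟨ ^-monoʳ-∣ p (+-monoʳ-≤ ℓ (m+n≤o⇒m≤o∸n c c+m≤n)) ⟩
      p ^ (ℓ + (n ∸ m))        ≡⟨ ^-distribˡ-+-* p ℓ (n ∸ m) ⟩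
      p ^ ℓ * p ^ (n ∸ m)      ∣⟨ *-monoˡ-∣ (p ^ (n ∸ m)) p^ℓ∣p^m*a ⟩
      p ^ m * a * p ^ (n ∸ m)  ≡⟨ reorder (p ^ m) a (p ^ (n ∸ m)) ⟩
      p ^ m * p ^ (n ∸ m) * a  ≡⟨ cong (_* a) (^-distribˡ-+-* p m (n ∸ m)) ⟨
      p ^ (m + (n ∸ m)) * a    ≡⟨ cong (λ e → p ^ e * a) (m+[n∸m]≡n (m+n≤o⇒n≤o c c+m≤n)) ⟩
      p ^ n * a                ∎
      where
      open ∣-Reasoning
      reorder : ∀ x y z → x * y * z ≡ x * z * y
      reorder = solve-∀
      c+m≤n : c + m ≤ n
      c+m≤n = bound (m∣m*n u)
      p^ℓ∣p^m*a : p ^ ℓ ∣ p ^ m * a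
      p^ℓ∣p^m*a = p^n∣m*u⇒p^n∣m ℓ p∤u (subst (p ^ ℓ ∣_) (reorder (p ^ m) u a) p^ℓ∣na)

    p^[ℓ+c]∣p^[1+k]*[1+n]C[1+k] : ∀ {ℓ n k} c → (∀ {m} → p ^ m ∣ suc k → c + m ≤ suc k) →
                                  p ^ ℓ ∣ suc n → p ^ (ℓ + c) ∣ p ^ suc k * (suc n C suc k)
    p^[ℓ+c]∣p^[1+k]*[1+n]C[1+k] {ℓ} {n} {k} c bound p^ℓ∣n = p^[ℓ+c]∣p^n*a {ℓ} c bound
      (subst (p ^ ℓ ∣_) (sym ([k+1]*[n+1]C[k+1]≡[n+1]*nCk n k)) (∣m⇒∣m*n (n C k) p^ℓ∣n))

open Arithmetic

open import Defs
open import Data.Nat as ℕ using (ℕ; zero; suc; _∸_; _≤_; _<_; _+_; z≤n; s≤s; NonZero)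
import Data.Nat.Properties as ℕ
import Data.Nat.Divisibility as ℕ
open import Data.Nat.Combinatorics using (_C_; nC1≡n)
open import Data.Nat.Primality using (Prime; prime⇒nonZero)
open import Data.Integer as ℤ using (ℤ; +_; 0ℤ; 1ℤ; ∣_∣; _*_; _^_; _/ℕ_; _%ℕ_)
import Data.Integer.Properties as ℤ
open import Data.Integer.DivMod using (a≡a%ℕn+[a/ℕn]*n; n%ℕd<d)
open import Data.Integer.Divisibility using (_∣_)
import Data.Integer.Divisibility.Signed as Signed
open import Data.List using ([]; _∷_; length; map; applyUpTo; upTo; replicate; _++_)
open import Data.List.Properties using (map-upTo)
open import Data.Product using (_×_; _,_; proj₁; proj₂)
open import Data.Sum using (_⊎_; inj₁; inj₂)
open import Function using (_∘_)
open import Relation.Nullary using (¬_; yes; no; contradiction)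
open import Relation.Binary.PropositionalEquality

-- The (unsigned) divisibility _∣_ on ℤ is ℕ-divisibility of absolute values, so + d ∣ a and
-- d ℕ.∣ ∣ a ∣ are the same type and proofs pass freely between them; Signed is used for sums.

∣+m^n∣≡m^n : ∀ m n → ∣ (+ m) ^ n ∣ ≡ m ℕ.^ n
∣+m^n∣≡m^n m zero    = refl
∣+m^n∣≡m^n m (suc n) = trans (ℤ.abs-* (+ m) ((+ m) ^ n)) (cong (m ℕ.*_) (∣+m^n∣≡m^n m n))

∣n⇒∣+m*n : ∀ {d} m n → + d ∣ n → + d ∣ + m * n
∣n⇒∣+m*n {d} m n d∣n = subst (d ℕ.∣_) (sym (ℤ.abs-* (+ m) n)) (ℕ.∣n⇒∣m*n m d∣n)

Ord-p^* : ∀ {p} .{{_ : NonZero p}} {a n} m → Ord p a n → Ord p (+ (p ℕ.^ m) * a) (m + n)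
Ord-p^* {p} {a} {n} m (p^n∣a , p^[1+n]∤a) = p^[m+n]∣p^m*a , p^[1+m+n]∤p^m*a
  where
  instance
    p^m≢0 : NonZero (p ℕ.^ m)
    p^m≢0 = ℕ.m^n≢0 p m
  p^[m+n]∣p^m*a : + (p ℕ.^ (m + n)) ∣ + (p ℕ.^ m) * a
  p^[m+n]∣p^m*a = subst₂ ℕ._∣_ (sym (ℕ.^-distribˡ-+-* p m n)) (sym (ℤ.abs-* (+ (p ℕ.^ m)) a))
                               (ℕ.*-monoʳ-∣ (p ℕ.^ m) p^n∣a)
  p^[1+m+n]∤p^m*a : ¬ + (p ℕ.^ suc (m + n)) ∣ + (p ℕ.^ m) * a
  p^[1+m+n]∤p^m*a p^[1+m+n]∣ = p^[1+n]∤a (ℕ.*-cancelˡ-∣ (p ℕ.^ m)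
    (subst₂ ℕ._∣_ (trans (cong (p ℕ.^_) (sym (ℕ.+-suc m n))) (ℕ.^-distribˡ-+-* p m (suc n)))
                  (ℤ.abs-* (+ (p ℕ.^ m)) a) p^[1+m+n]∣))

module _ {d : ℕ} (a : ℤ) (m : ℕ) .{{_ : NonZero m}} (d∣m : d ℕ.∣ m) where

  private
    d∣[a/m]*m : + d Signed.∣ (a /ℕ m) * + m
    d∣[a/m]*m = Signed.∣n⇒∣m*n (a /ℕ m) (Signed.∣ᵤ⇒∣ {i = + m} d∣m)

  ∣%ℕ⇒∣ : d ℕ.∣ a %ℕ m → + d ∣ a
  ∣%ℕ⇒∣ d∣a%m = Signed.∣⇒∣ᵤ (subst (_ Signed.∣_) (sym (a≡a%ℕn+[a/ℕn]*n a m))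
    (Signed.∣m∣n⇒∣m+n (Signed.∣ᵤ⇒∣ {i = + (a %ℕ m)} d∣a%m) d∣[a/m]*m))

  ∣⇒∣%ℕ : + d ∣ a → d ℕ.∣ a %ℕ m
  ∣⇒∣%ℕ d∣a = Signed.∣⇒∣ᵤ {i = + (a %ℕ m)}
    (Signed.∣m+n∣n⇒∣m (subst (_ Signed.∣_) (a≡a%ℕn+[a/ℕn]*n a m) (Signed.∣ᵤ⇒∣ d∣a)) d∣[a/m]*m)

module _ (a : ℤ) (n : ℕ) .{{_ : NonZero n}} (n∣a : + n ∣ a) where

  ∣⇒%ℕ≡0 : a %ℕ n ≡ 0
  ∣⇒%ℕ≡0 with a %ℕ n | n%ℕd<d a n | ∣⇒∣%ℕ a n ℕ.∣-refl n∣a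
  ... | zero  | _   | _   = refl
  ... | suc r | r<n | n∣r = contradiction n∣r (ℕ.>⇒∤ r<n)

  ∣a∣≡∣a/ℕn∣*n : ∣ a ∣ ≡ ∣ a /ℕ n ∣ ℕ.* n
  ∣a∣≡∣a/ℕn∣*n = begin
    ∣ a ∣                            ≡⟨ cong ∣_∣ (a≡a%ℕn+[a/ℕn]*n a n) ⟩
    ∣ + (a %ℕ n) ℤ.+ a /ℕ n * + n ∣  ≡⟨ cong (λ r → ∣ + r ℤ.+ a /ℕ n * + n ∣) ∣⇒%ℕ≡0 ⟩
    ∣ 0ℤ ℤ.+ a /ℕ n * + n ∣          ≡⟨ cong ∣_∣ (ℤ.+-identityˡ (a /ℕ n * + n)) ⟩
    ∣ a /ℕ n * + n ∣                 ≡⟨ ℤ.abs-* (a /ℕ n) (+ n) ⟩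
    ∣ a /ℕ n ∣ ℕ.* n                 ∎
    where open ≡-Reasoning

  ∣/ℕ⇒*∣ : ∀ {d} → + d ∣ a /ℕ n → + (d ℕ.* n) ∣ a
  ∣/ℕ⇒*∣ d∣a/n = subst (_ ℕ.∣_) (sym ∣a∣≡∣a/ℕn∣*n) (ℕ.*-monoˡ-∣ n d∣a/n)

  *∣⇒∣/ℕ : ∀ {d} → + (d ℕ.* n) ∣ a → + d ∣ a /ℕ n
  *∣⇒∣/ℕ dn∣a = ℕ.*-cancelʳ-∣ n (subst (_ ℕ.∣_) ∣a∣≡∣a/ℕn∣*n dn∣a)

coeff-applyUpTo : ∀ (h : ℕ → ℤ) n j → j < n → coeff (applyUpTo h n) j ≡ h j
coeff-applyUpTo h (suc n) zero    _         = refl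
coeff-applyUpTo h (suc n) (suc j) (s≤s j<n) = coeff-applyUpTo (h ∘ suc) n j j<n

coeff-applyUpTo-≥ : ∀ (h : ℕ → ℤ) n j → n ≤ j → coeff (applyUpTo h n) j ≡ 0ℤ
coeff-applyUpTo-≥ h zero    j       _         = refl
coeff-applyUpTo-≥ h (suc n) (suc j) (s≤s n≤j) = coeff-applyUpTo-≥ (h ∘ suc) n j n≤j

coeffSum : (ℕ → ℤ → ℤ) → Poly → ℤ
coeffSum F []      = 0ℤ
coeffSum F (a ∷ g) = F 0 a ℤ.+ coeffSum (F ∘ suc) g

sumℤ-coeffs≡coeffSum : ∀ F g → sumℤ (map (λ j → F j (coeff g j)) (upTo (length g))) ≡ coeffSum F g
sumℤ-coeffs≡coeffSum F g = trans (cong sumℤ (map-upTo _ (length g))) (applyUpTo-coeffs F g)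
  where
  applyUpTo-coeffs : ∀ F g → sumℤ (applyUpTo (λ j → F j (coeff g j)) (length g)) ≡ coeffSum F g
  applyUpTo-coeffs F []      = refl
  applyUpTo-coeffs F (a ∷ g) = cong (ℤ._+_ (F 0 a)) (applyUpTo-coeffs (F ∘ suc) g)

∣-coeffSum : ∀ {q} F g → (∀ j → q Signed.∣ F j (coeff g j)) → q Signed.∣ coeffSum F g
∣-coeffSum F []      _  = Signed.divides 0ℤ refl
∣-coeffSum F (a ∷ g) q∣ = Signed.∣m∣n⇒∣m+n (q∣ 0) (∣-coeffSum (F ∘ suc) g (q∣ ∘ suc))

∣-coeffSum-term : ∀ {q} F g k → (∀ j → F j 0ℤ ≡ 0ℤ) → (∀ j → j ≢ k → q Signed.∣ F j (coeff g j)) →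
                  q Signed.∣ coeffSum F g → q Signed.∣ F k (coeff g k)
∣-coeffSum-term F []      k       F0≡0 _  _  =
  subst (_ Signed.∣_) (sym (F0≡0 k)) (Signed.divides 0ℤ refl)
∣-coeffSum-term F (a ∷ g) zero    _    q∣ q∣Σ =
  Signed.∣m+n∣n⇒∣m q∣Σ (∣-coeffSum (F ∘ suc) g (λ j → q∣ (suc j) (λ ())))
∣-coeffSum-term F (a ∷ g) (suc k) F0≡0 q∣ q∣Σ =
  ∣-coeffSum-term (F ∘ suc) g k (F0≡0 ∘ suc) (λ j j≢k → q∣ (suc j) (j≢k ∘ ℕ.suc-injective))
    (Signed.∣m+n∣m⇒∣n q∣Σ (q∣ 0 (λ ())))

∣eval⇒∣coeff₀ : ∀ {q} g z → (∀ j → + q ∣ coeff g (suc j)) → + q ∣ eval g z → + q ∣ coeff g 0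
∣eval⇒∣coeff₀ {q} g z q∣cⱼ q∣g[z] = Signed.∣⇒∣ᵤ (subst (+ q Signed.∣_) (ℤ.*-identityʳ (coeff g 0))
  (∣-coeffSum-term F g 0 (λ _ → refl) q∣Fⱼ
    (Signed.∣ᵤ⇒∣ (subst (+ q ∣_) (sumℤ-coeffs≡coeffSum F g) q∣g[z]))))
  where
  F : ℕ → ℤ → ℤ
  F j c = c * z ^ j
  q∣Fⱼ : ∀ j → j ≢ 0 → + q Signed.∣ F j (coeff g j)
  q∣Fⱼ zero    j≢0 = contradiction refl j≢0
  q∣Fⱼ (suc j) _   = Signed.∣m⇒∣m*n (z ^ suc j) (Signed.∣ᵤ⇒∣ {i = coeff g (suc j)} (q∣cⱼ j))

∣evalDeriv⇒∣coeff₁ : ∀ {q} g z → (∀ j → + q ∣ + (2 + j) * coeff g (2 + j)) →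
                     + q ∣ evalDeriv g z → + q ∣ coeff g 1
∣evalDeriv⇒∣coeff₁ {q} g z q∣jcⱼ q∣g′[z] = Signed.∣⇒∣ᵤ (subst (+ q Signed.∣_) F₁≡c₁
  (∣-coeffSum-term F g 1 (λ j → cong (_* z ^ (j ∸ 1)) (ℤ.*-zeroʳ (+ j))) q∣Fⱼ
    (Signed.∣ᵤ⇒∣ (subst (+ q ∣_) (sumℤ-coeffs≡coeffSum F g) q∣g′[z]))))
  where
  F : ℕ → ℤ → ℤ
  F j c = + j * c * z ^ (j ∸ 1)
  F₁≡c₁ : F 1 (coeff g 1) ≡ coeff g 1
  F₁≡c₁ = trans (ℤ.*-identityʳ (+ 1 * coeff g 1)) (ℤ.*-identityˡ (coeff g 1))
  q∣Fⱼ : ∀ j → j ≢ 1 → + q Signed.∣ F j (coeff g j)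
  q∣Fⱼ zero          _   = Signed.divides 0ℤ refl
  q∣Fⱼ (suc zero)    j≢1 = contradiction refl j≢1
  q∣Fⱼ (suc (suc j)) _   =
    Signed.∣m⇒∣m*n (z ^ suc j) (Signed.∣ᵤ⇒∣ {i = + (2 + j) * coeff g (2 + j)} (q∣jcⱼ j))

module _ (c₁ c₂ : ℤ) (d : ℕ) where

  private
    coeffSum-zeros++ : ∀ F n c → (∀ j → F j 0ℤ ≡ 0ℤ) → coeffSum F (replicate n 0ℤ ++ c ∷ []) ≡ F n c
    coeffSum-zeros++ F zero    c _    = ℤ.+-identityʳ (F 0 c)
    coeffSum-zeros++ F (suc n) c F0≡0 =
      trans (cong (ℤ._+ coeffSum (F ∘ suc) (replicate n 0ℤ ++ c ∷ [])) (F0≡0 0))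
            (trans (ℤ.+-identityˡ _) (coeffSum-zeros++ (F ∘ suc) n c (F0≡0 ∘ suc)))

    length-zeros++ : ∀ n c → length (replicate n 0ℤ ++ c ∷ []) ≡ suc n
    length-zeros++ zero    c = refl
    length-zeros++ (suc n) c = cong suc (length-zeros++ n c)

  coeffSum-binomial : ∀ F → (∀ j → F j 0ℤ ≡ 0ℤ) →
                      coeffSum F (binomial c₁ c₂ (suc d)) ≡ F 0 c₁ ℤ.+ F (suc d) c₂
  coeffSum-binomial F F0≡0 = cong (ℤ._+_ (F 0 c₁)) (coeffSum-zeros++ (F ∘ suc) d c₂ (F0≡0 ∘ suc))

  length-binomial : length (binomial c₁ c₂ (suc d)) ≡ 2 + d
  length-binomial = cong suc (length-zeros++ d c₂)

  eval-binomial-0 : eval (binomial c₁ c₂ (suc d)) 0ℤ ≡ c₁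
  eval-binomial-0 = begin
    eval (binomial c₁ c₂ (suc d)) 0ℤ     ≡⟨ sumℤ-coeffs≡coeffSum F (binomial c₁ c₂ (suc d)) ⟩
    coeffSum F (binomial c₁ c₂ (suc d))  ≡⟨ coeffSum-binomial F (λ _ → refl) ⟩
    c₁ * 1ℤ ℤ.+ c₂ * 0ℤ                  ≡⟨ cong₂ ℤ._+_ (ℤ.*-identityʳ c₁) (ℤ.*-zeroʳ c₂) ⟩
    c₁ ℤ.+ 0ℤ                            ≡⟨ ℤ.+-identityʳ c₁ ⟩
    c₁                                   ∎
    where
    open ≡-Reasoning
    F : ℕ → ℤ → ℤ
    F j c = c * 0ℤ ^ j

  taylor-binomial : ∀ z i →
                    taylor (binomial c₁ c₂ (suc d)) z (suc i) ≡ + (suc d C suc i) * c₂ * z ^ (d ∸ i)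
  taylor-binomial z i = begin
    taylor (binomial c₁ c₂ (suc d)) z (suc i)  ≡⟨ sumℤ-coeffs≡coeffSum F (binomial c₁ c₂ (suc d)) ⟩
    coeffSum F (binomial c₁ c₂ (suc d))        ≡⟨ coeffSum-binomial F F0≡0 ⟩
    0ℤ ℤ.+ F (suc d) c₂                        ≡⟨ ℤ.+-identityˡ _ ⟩
    + (suc d C suc i) * c₂ * z ^ (d ∸ i)       ∎
    where
    open ≡-Reasoning
    F : ℕ → ℤ → ℤ
    F j c = + (j C suc i) * c * z ^ (j ∸ suc i)
    F0≡0 : ∀ j → F j 0ℤ ≡ 0ℤ
    F0≡0 j = cong (_* z ^ (j ∸ suc i)) (ℤ.*-zeroʳ (+ (j C suc i)))

shiftCoeff : ℕ → Poly → ℕ → ℕ → ℤ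
shiftCoeff p g ζ j = + (p ℕ.^ j) * taylor g (+ ζ) j

module ChildPoly (p : ℕ) .{{_ : NonZero p}} (g : Poly) (ζ s k : ℕ) where

  private instance
    p^s≢0 : NonZero (p ℕ.^ s)
    p^s≢0 = ℕ.m^n≢0 p s
    p^k≢0 : NonZero (p ℕ.^ k)
    p^k≢0 = ℕ.m^n≢0 p k

  private
    p∣p^k : 1 ≤ k → p ℕ.∣ p ℕ.^ k
    p∣p^k 1≤k = ℕ.∣-trans (ℕ.∣-reflexive (sym (ℕ.*-identityʳ p))) (^-monoʳ-∣ p 1≤k)

  coeff-childPoly : ∀ j → j < length g →
                    coeff (childPoly p g ζ s k) j ≡ + (shiftCoeff p g ζ j /ℕ p ℕ.^ s %ℕ p ℕ.^ k)
  coeff-childPoly j j<len = trans (cong (λ h → coeff h j) (map-upTo _ (length g)))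
                                  (coeff-applyUpTo _ (length g) j j<len)

  coeff-childPoly-≥ : ∀ j → length g ≤ j → coeff (childPoly p g ζ s k) j ≡ 0ℤ
  coeff-childPoly-≥ j len≤j = trans (cong (λ h → coeff h j) (map-upTo _ (length g)))
                                    (coeff-applyUpTo-≥ _ (length g) j len≤j)

  p∣coeff-childPoly : ∀ j → 1 ≤ k → + (p ℕ.^ suc s) ∣ shiftCoeff p g ζ j →
                      + p ∣ coeff (childPoly p g ζ s k) j
  p∣coeff-childPoly j 1≤k p^[1+s]∣Y with j ℕ.<? length g
  ... | yes j<len = subst (+ p ∣_) (sym (coeff-childPoly j j<len))
    (∣⇒∣%ℕ (Y /ℕ p ℕ.^ s) (p ℕ.^ k) (p∣p^k 1≤k) (*∣⇒∣/ℕ Y (p ℕ.^ s) p^s∣Y p^[1+s]∣Y))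
    where
    Y = shiftCoeff p g ζ j
    p^s∣Y : + (p ℕ.^ s) ∣ Y
    p^s∣Y = ℕ.∣-trans (ℕ.n∣m*n p) p^[1+s]∣Y
  ... | no  j≮len = subst (+ p ∣_) (sym (coeff-childPoly-≥ j (ℕ.≮⇒≥ j≮len))) (p ℕ.∣0)

  p∣coeff-childPoly⁻¹ : ∀ j → 1 ≤ k → j < length g → + (p ℕ.^ s) ∣ shiftCoeff p g ζ j →
                        + p ∣ coeff (childPoly p g ζ s k) j → + (p ℕ.^ suc s) ∣ shiftCoeff p g ζ j
  p∣coeff-childPoly⁻¹ j 1≤k j<len p^s∣Y p∣cⱼ = ∣/ℕ⇒*∣ Y (p ℕ.^ s) p^s∣Y
    (∣%ℕ⇒∣ (Y /ℕ p ℕ.^ s) (p ℕ.^ k) (p∣p^k 1≤k) (subst (+ p ∣_) (coeff-childPoly j j<len) p∣cⱼ))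
    where Y = shiftCoeff p g ζ j

module BinomialTree {p : ℕ} (pr : Prime p) (c₁ c₂ : ℤ) (d : ℕ) (p∤c₁c₂ : ¬ + p ∣ c₁ * c₂)
                    (ℓ : ℕ) (ord-d : Ord p (+ suc d) ℓ) where

  open PrimePowers pr

  private instance
    p≢0 : NonZero p
    p≢0 = prime⇒nonZero pr

  f : Poly
  f = binomial c₁ c₂ (suc d)

  p∤c₁ : ¬ + p ∣ c₁
  p∤c₁ p∣c₁ = p∤c₁c₂ (subst (p ℕ.∣_) (sym (ℤ.abs-* c₁ c₂)) (ℕ.∣m⇒∣m*n ∣ c₂ ∣ p∣c₁))

  p∤c₂ : ¬ + p ∣ c₂
  p∤c₂ p∣c₂ = p∤c₁c₂ (subst (p ℕ.∣_) (sym (ℤ.abs-* c₁ c₂)) (ℕ.∣n⇒∣m*n ∣ c₁ ∣ p∣c₂))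

  root⇒p∤ζ : ∀ {ζ} → ζ < p → + p ∣ eval f (+ ζ) → ¬ p ℕ.∣ ζ
  root⇒p∤ζ {zero}  _   p∣f[0] _ = p∤c₁ (subst (+ p ∣_) (eval-binomial-0 c₁ c₂ d) p∣f[0])
  root⇒p∤ζ {suc _} ζ<p _        = ℕ.>⇒∤ ζ<p

  module AtUnit {ζ₀ : ℕ} (p∤ζ₀ : ¬ p ℕ.∣ ζ₀) where

    unit : ℕ → ℕ
    unit e = ∣ c₂ ∣ ℕ.* ζ₀ ℕ.^ e

    p∤unit : ∀ e → ¬ p ℕ.∣ unit e
    p∤unit e = ∤-* p∤c₂ (∤-^ e p∤ζ₀)

    ∣taylor∣ : ∀ i → ∣ taylor f (+ ζ₀) (suc i) ∣ ≡ (suc d C suc i) ℕ.* unit (d ∸ i)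
    ∣taylor∣ i = begin
      ∣ taylor f (+ ζ₀) (suc i) ∣                   ≡⟨ cong ∣_∣ (taylor-binomial c₁ c₂ d (+ ζ₀) i) ⟩
      ∣ + n * c₂ * (+ ζ₀) ^ (d ∸ i) ∣               ≡⟨ ℤ.abs-* (+ n * c₂) _ ⟩
      ∣ + n * c₂ ∣ ℕ.* ∣ (+ ζ₀) ^ (d ∸ i) ∣         ≡⟨ cong₂ ℕ._*_ (ℤ.abs-* (+ n) c₂) (∣+m^n∣≡m^n ζ₀ (d ∸ i)) ⟩
      n ℕ.* ∣ c₂ ∣ ℕ.* ζ₀ ℕ.^ (d ∸ i)               ≡⟨ ℕ.*-assoc n ∣ c₂ ∣ _ ⟩
      n ℕ.* unit (d ∸ i)                            ∎
      where
      open ≡-Reasoning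
      n = suc d C suc i

    ord-taylor₁ : Ord p (taylor f (+ ζ₀) 1) ℓ
    ord-taylor₁ = subst (p ℕ.^ ℓ ℕ.∣_) (sym ∣T₁∣) (ℕ.∣m⇒∣m*n (unit d) (proj₁ ord-d))
                , λ p^[1+ℓ]∣T₁ → proj₂ ord-d
                    (p^n∣m*u⇒p^n∣m (suc ℓ) (p∤unit d) (subst (_ ℕ.∣_) ∣T₁∣ p^[1+ℓ]∣T₁))
      where
      ∣T₁∣ : ∣ taylor f (+ ζ₀) 1 ∣ ≡ suc d ℕ.* unit d
      ∣T₁∣ = trans (∣taylor∣ 0) (cong (ℕ._* unit d) (nC1≡n (suc d)))

    s≤ℓ+1 : ∀ {s} → IsS p f ζ₀ s → s ≤ ℓ + 1
    s≤ℓ+1 {s} (_ , minimal) = subst (s ≤_) (ℕ.+-comm 1 ℓ) (minimal 1 ℓ T₁≢0 ord-taylor₁)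
      where
      T₁≢0 : taylor f (+ ζ₀) 1 ≢ 0ℤ
      T₁≢0 T₁≡0 = proj₂ ord-taylor₁ (subst (λ t → + (p ℕ.^ suc ℓ) ∣ t) (sym T₁≡0) (_ ℕ.∣0))

    p^[ℓ+c]∣shiftCoeff : ∀ c i → (∀ {m} → p ℕ.^ m ℕ.∣ suc i → c + m ≤ suc i) →
                         + (p ℕ.^ (ℓ + c)) ∣ shiftCoeff p f ζ₀ (suc i)
    p^[ℓ+c]∣shiftCoeff c i bound = subst (_ ℕ.∣_) (sym ∣shiftCoeff∣)
      (ℕ.∣m⇒∣m*n (unit (d ∸ i)) (p^[ℓ+c]∣p^[1+k]*[1+n]C[1+k] {ℓ} c bound (proj₁ ord-d)))
      where
      ∣shiftCoeff∣ : ∣ shiftCoeff p f ζ₀ (suc i) ∣ ≡ p ℕ.^ suc i ℕ.* (suc d C suc i) ℕ.* unit (d ∸ i)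
      ∣shiftCoeff∣ = trans (ℤ.abs-* (+ (p ℕ.^ suc i)) _)
                      (trans (cong (p ℕ.^ suc i ℕ.*_) (∣taylor∣ i)) (sym (ℕ.*-assoc (p ℕ.^ suc i) _ _)))

    ord-shiftCoeff₁ : Ord p (shiftCoeff p f ζ₀ 1) (1 + ℓ)
    ord-shiftCoeff₁ = Ord-p^* {n = ℓ} 1 ord-taylor₁

    module Child {s : ℕ} (s≤ℓ+1 : s ≤ ℓ + 1) {k : ℕ} (1≤k : 1 ≤ k) where

      g : Poly
      g = childPoly p f ζ₀ s k

      open ChildPoly p f ζ₀ s k

      p∣higher-coeff : ∀ j → 2 ≤ j → 3 ≤ p ⊎ 3 ≤ j → + p ∣ coeff g j
      p∣higher-coeff (suc i) 2≤j 3≤p∨3≤j = p∣coeff-childPoly (suc i) 1≤k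
        (ℕ.∣-trans (^-monoʳ-∣ p 1+s≤ℓ+2) (p^[ℓ+c]∣shiftCoeff 2 i (p^m∣n⇒2+m≤n 2≤j 3≤p∨3≤j)))
        where
        1+s≤ℓ+2 : suc s ≤ ℓ + 2
        1+s≤ℓ+2 = subst (suc s ≤_) (sym (ℕ.+-suc ℓ 1)) (s≤s s≤ℓ+1)

      degree-bound : (p ≡ 2 → DegRedLe p g 2) × (3 ≤ p → DegRedLe p g 1)
      degree-bound = (λ _ j 2<j → p∣higher-coeff j (ℕ.<⇒≤ 2<j) (inj₂ 2<j))
                   , (λ 3≤p j 1<j → p∣higher-coeff j 1<j (inj₁ 3≤p))

      p∣[2+j]*coeff : ∀ j → + p ∣ + (2 + j) * coeff g (2 + j)
      p∣[2+j]*coeff (suc j) = ∣n⇒∣+m*n (3 + j) (coeff g (3 + j))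
        (p∣higher-coeff (3 + j) (s≤s (s≤s z≤n)) (inj₂ (s≤s (s≤s (s≤s z≤n)))))
      p∣[2+j]*coeff zero with 3 ℕ.≤? p
      ... | yes 3≤p = ∣n⇒∣+m*n 2 (coeff g 2) (p∣higher-coeff 2 ℕ.≤-refl (inj₁ 3≤p))
      ... | no  3≰p = subst (p ℕ.∣_) (sym (ℤ.abs-* (+ 2) (coeff g 2))) (ℕ.∣m⇒∣m*n ∣ coeff g 2 ∣ p∣2)
        where
        p∣2 : p ℕ.∣ 2
        p∣2 = ℕ.∣-reflexive (ℕ.≤-antisym (ℕ.≤-pred (ℕ.≰⇒> 3≰p)) 1<p)

      p∤coeff₁ : s ≡ 1 + ℓ → ¬ + p ∣ coeff g 1
      p∤coeff₁ s≡1+ℓ p∣c₁ = proj₂ ord-shiftCoeff₁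
        (subst (λ e → + (p ℕ.^ suc e) ∣ shiftCoeff p f ζ₀ 1) s≡1+ℓ
          (p∣coeff-childPoly⁻¹ 1 1≤k 1<len p^s∣shiftCoeff₁ p∣c₁))
        where
        1<len : 1 < length f
        1<len = subst (1 <_) (sym (length-binomial c₁ c₂ d)) (s≤s (s≤s z≤n))
        p^s∣shiftCoeff₁ : + (p ℕ.^ s) ∣ shiftCoeff p f ζ₀ 1
        p^s∣shiftCoeff₁ = subst (λ e → + (p ℕ.^ e) ∣ shiftCoeff p f ζ₀ 1) (sym s≡1+ℓ)
                                (proj₁ ord-shiftCoeff₁)

      ¬degenerate : ∀ {ζ₁} → RedNonzero p g → ¬ DegenerateRoot p g ζ₁
      ¬degenerate {ζ₁} (j , p∤cⱼ) (_ , p∣g[ζ₁] , p∣g′[ζ₁]) with ℕ.m≤n⇒m<n∨m≡n s≤ℓ+1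
      ... | inj₁ s<ℓ+1 = p∤cⱼ (p∣coeffs j)
        where
        p∣coeff-suc : ∀ j → + p ∣ coeff g (suc j)
        p∣coeff-suc j = p∣coeff-childPoly (suc j) 1≤k
          (ℕ.∣-trans (^-monoʳ-∣ p s<ℓ+1) (p^[ℓ+c]∣shiftCoeff 1 j p^m∣n⇒1+m≤n))
        p∣coeffs : ∀ j → + p ∣ coeff g j
        p∣coeffs zero    = ∣eval⇒∣coeff₀ g (+ ζ₁) p∣coeff-suc p∣g[ζ₁]
        p∣coeffs (suc j) = p∣coeff-suc j
      ... | inj₂ s≡ℓ+1 = p∤coeff₁ (trans s≡ℓ+1 (ℕ.+-comm ℓ 1))
                                  (∣evalDeriv⇒∣coeff₁ g (+ ζ₁) p∣[2+j]*coeff p∣g′[ζ₁])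

  nonroot⇒¬degenerate : ∀ {k i μ g k′ ζ} → Node p f k (suc i) μ g k′ →
                        RedNonzero p g → ¬ DegenerateRoot p g ζ
  nonroot⇒¬degenerate (child ζ₀ s root _ (ζ₀<p , p∣f[ζ₀] , _) isS _ s<k) =
    Child.¬degenerate (s≤ℓ+1 isS) (ℕ.m<n⇒0<n∸m s<k)
    where open AtUnit (root⇒p∤ζ ζ₀<p p∣f[ζ₀])
  nonroot⇒¬degenerate (child _ _ node@(child _ _ _ _ _ _ _ _) g≢0 g-degenerate _ _ _) _ _ =
    nonroot⇒¬degenerate node g≢0 g-degenerate

  nonroot-degree-bound : ∀ {k i μ g k′} → Node p f k (suc i) μ g k′ →
                         (p ≡ 2 → DegRedLe p g 2) × (3 ≤ p → DegRedLe p g 1)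
  nonroot-degree-bound (child ζ₀ s root _ (ζ₀<p , p∣f[ζ₀] , _) isS _ s<k) =
    Child.degree-bound (s≤ℓ+1 isS) (ℕ.m<n⇒0<n∸m s<k)
    where open AtUnit (root⇒p∤ζ ζ₀<p p∣f[ζ₀])
  nonroot-degree-bound (child _ _ node@(child _ _ _ _ _ _ _ _) g≢0 g-degenerate _ _ _) =
    contradiction g-degenerate (nonroot⇒¬degenerate node g≢0)

lemma2p17 : (p : ℕ) (pr : Prime p) (c₁ c₂ : ℤ) (d : ℕ) → 1 ≤ d →
            ¬ (+ p ∣ (c₁ * c₂)) → (ℓ : ℕ) → Ord p (+ d) ℓ →
            ((k i ζ : ℕ) (g : Poly) (k' : ℕ) →
               IsNode p pr (binomial c₁ c₂ d) k (suc i) ζ g k' →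
               (p ≡ 2 → DegRedLe p g 2) × (3 ≤ p → DegRedLe p g 1))
            × ((ζ₀ : ℕ) → DegenerateRoot p (binomial c₁ c₂ d) ζ₀ →
               (s : ℕ) → IsS p (binomial c₁ c₂ d) ζ₀ s → s ≤ ℓ + 1)
lemma2p17 p pr c₁ c₂ (suc d) _ p∤c₁c₂ ℓ ord-d =
    (λ _ _ _ _ _ → nonroot-degree-bound)
  , (λ _ (ζ₀<p , p∣f[ζ₀] , _) _ → AtUnit.s≤ℓ+1 (root⇒p∤ζ ζ₀<p p∣f[ζ₀]))
  where open BinomialTree pr c₁ c₂ d p∤c₁c₂ ℓ ord-d
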